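{- Let $q$ range over prime powers and let $N(q)$ denote the minimum number $N$ of parts in a partition $\{A^i\}_{i=1}^N$ of $(\mathbb{F}_q P^2)^2$ such that (1) each part is a product set $A^i = A^i_1 \times A^i_2$ with $A^i_1, A^i_2 \subseteq \mathbb{F}_q P^2$, and (2) for each $i$ there is a projective line $L^i \subseteq \mathbb{F}_q P^2$ with $A^i \subseteq L^i \times L^i$. Then $N(q) = \Theta(q^3)$, i.e. there are absolute constants $c, C > 0$ such that $c q^3 \le N(q) \le C q^3$ for every prime power $q$.
   Context: $\mathbb{F}_q P^n$ denotes the $n$-dimensional projective space over the finite field $\mathbb{F}_q$: its points are the $1$-dimensional linear subspaces of $\mathbb{F}_q^{n+1}$. A flat (subspace) of $\mathbb{F}_q P^n$ is the set of points contained in a linear subspace $U$ of $\mathbb{F}_q^{n+1}$, and its dimension is $\dim U - 1$ (the empty flat has dimension $-1$). Projective lines are flats of dimension $1$. -}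

module Defs where

open import Level using (0ℓ)
open import Data.Nat using (ℕ)
open import Data.Fin using (Fin)
open import Data.Product using (Σ; ∃; _×_; _,_)
open import Relation.Binary.PropositionalEquality using (_≡_; _≢_)
open import Relation.Nullary using (¬_)
open import Algebra.Structures using (IsCommutativeRing)

-- A finite field with exactly q elements, its carrier being Fin q
-- (every finite field of order q is isomorphic to such a structure).
record FiniteField (q : ℕ) : Set where
  field
    _+_ _*_ : Fin q → Fin q → Fin q
    -_      : Fin q → Fin q
    0# 1#   : Fin q
    isCommutativeRing : IsCommutativeRing _≡_ _+_ _*_ -_ 0# 1#
    0≢1     : 0# ≢ 1#
    inverse : ∀ x → x ≢ 0# → Σ (Fin q) (λ y → (x * y) ≡ 1#)
  infixl 6 _+_
  infixl 7 _*_

module _ {q : ℕ} (F : FiniteField q) where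
  open FiniteField F

  K : Set
  K = Fin q

  -- Points of F_q P^2, each 1-dimensional subspace of F_q^3 represented
  -- by its unique normalised spanning vector (first nonzero coordinate = 1):
  -- [1:a:b], [0:1:b], [0:0:1].
  data Point : Set where
    pt₁ : K → K → Point
    pt₂ : K → Point
    pt₃ : Point

  coords : Point → K × K × K
  coords (pt₁ a b) = 1# , a , b
  coords (pt₂ b)   = 0# , 1# , b
  coords pt₃       = 0# , 0# , 1#

  InSpan : Point → Point → K × K × K → Set
  InSpan P Q (x₀ , x₁ , x₂) with coords P | coords Q
  ... | (u₀ , u₁ , u₂) | (v₀ , v₁ , v₂) =
    ∃ λ (λ' : K) → ∃ λ (μ : K) →
      (x₀ ≡ λ' * u₀ + μ * v₀) × (x₁ ≡ λ' * u₁ + μ * v₁) × (x₂ ≡ λ' * u₂ + μ * v₂)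

  -- A projective line (flat of dimension 1): the set of points contained in a
  -- 2-dimensional linear subspace of F_q^3. Every such subspace is spanned by
  -- (representatives of) two distinct points, so a line is given by two distinct points.
  record Line : Set where
    constructor line
    field
      P Q   : Point
      P≢Q   : P ≢ Q

  OnLine : Line → Point → Set
  OnLine L X = InSpan (Line.P L) (Line.Q L) (coords X)

  record LinePartition (N : ℕ) : Set₁ where
    field
      A₁ A₂ : Fin N → Point → Set
      covers   : ∀ x y → ∃ λ i → A₁ i x × A₂ i y
      disjoint : ∀ x y i j → A₁ i x × A₂ i y → A₁ j x × A₂ j y → i ≡ j
      nonempty : ∀ i → ∃ λ x → ∃ λ y → A₁ i x × A₂ i y
      inLine   : ∀ i → ∃ λ (L : Line) →
                   ∀ x y → A₁ i x → A₂ i y → OnLine L x × OnLine L y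

module Submission where

-- Upper bound: for each point x and each of the q + 1 lines L through x take the part {x} × L,
-- the pair (x , x) being assigned to one chosen line; these are (q² + q + 1)(q + 1) parts.
--
-- Lower bound: restrict the partition to G × G for each of the q² affine lines G : y = m x + b.
-- A part meeting G × G off the diagonal lies in L × L for a line L meeting G twice, so L = G:
-- such a part is associated with a single G. Identifying G with F_q, the parts restricted to G × G
-- are rectangles, and those meeting it off the diagonal cover every off-diagonal cell. A rank
-- argument over GF(2) shows there are at least q − 1 − d of them, where d is the number of
-- diagonal cells they also cover. A diagonal cell (P , P) is covered in this way for at most one
-- G through P, so summing over G gives q³ ≤ q² + N + q², i.e. N ≥ q³ − 2q².

open import Defs
open import Data.Nat using (ℕ)
open import Algebra.Bundles using (CommutativeRing)

-- The ring solver needs coefficients with decidable equality; ℤ maps into every commutative ring.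
module IntegerCoefficients {c ℓ} (R : CommutativeRing c ℓ) where
  open import Data.Nat as ℕ using (zero; suc)
  import Data.Nat.Properties as ℕ
  open import Data.Integer as ℤ using (ℤ; +_; -[1+_]; _⊖_)
  import Data.Integer.Properties as ℤ
  open import Data.Sign as Sign using ()
  open import Data.Maybe using (Maybe; just; nothing)
  open import Relation.Nullary using (yes; no)
  open import Relation.Binary.PropositionalEquality as ≡ using (_≡_)
  open import Algebra.Solver.Ring.AlmostCommutativeRing
    using (fromCommutativeRing; _-Raw-AlmostCommutative⟶_)

  open CommutativeRing R
  open import Algebra.Properties.Ring ring using (-‿involutive; -0#≈0#; -‿distribˡ-*; -‿distribʳ-*)
  open import Algebra.Properties.AbelianGroup +-abelianGroup using (⁻¹-∙-comm)
  open import Algebra.Properties.Semiring.Mult.TCOptimised semiring using (_×_; ×-homo-+; ×1-homo-*)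
  open import Relation.Binary.Reasoning.Setoid setoid

  fromℤ : ℤ → Carrier
  fromℤ (+ n)      = n × 1#
  fromℤ -[1+ n ]   = - (suc n × 1#)

  ⊖-homo : ∀ m n → fromℤ (m ⊖ n) ≈ m × 1# - n × 1#
  ⊖-homo m zero = begin
    fromℤ (m ⊖ 0)   ≡⟨ ≡.cong fromℤ (ℤ.⊖-≥ {m} {0} ℕ.z≤n) ⟩
    m × 1#          ≈⟨ +-identityʳ _ ⟨
    m × 1# + 0#     ≈⟨ +-congˡ -0#≈0# ⟨
    m × 1# - 0#     ∎
  ⊖-homo zero (suc n) = begin
    fromℤ (0 ⊖ suc n)  ≡⟨ ≡.cong fromℤ (ℤ.⊖-< {0} {suc n} (ℕ.s≤s ℕ.z≤n)) ⟩
    - (suc n × 1#)     ≈⟨ +-identityˡ _ ⟨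
    0# - suc n × 1#    ∎
  ⊖-homo (suc m) (suc n) = begin
    fromℤ (suc m ⊖ suc n)              ≡⟨ ≡.cong fromℤ (ℤ.[1+m]⊖[1+n]≡m⊖n m n) ⟩
    fromℤ (m ⊖ n)                      ≈⟨ ⊖-homo m n ⟩
    m × 1# - n × 1#                    ≈⟨ +-identityˡ _ ⟨
    0# + (m × 1# - n × 1#)             ≈⟨ +-congʳ (-‿inverseʳ 1#) ⟨
    (1# - 1#) + (m × 1# - n × 1#)      ≈⟨ middle-swap 1# (m × 1#) (- 1#) (- (n × 1#)) ⟩
    (1# + m × 1#) + (- 1# - n × 1#)    ≈⟨ +-congˡ (⁻¹-∙-comm 1# (n × 1#)) ⟩
    (1# + m × 1#) - (1# + n × 1#)      ≈⟨ +-cong (×-homo-+ 1# 1 m) (-‿cong (×-homo-+ 1# 1 n)) ⟨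
    suc m × 1# - suc n × 1#            ∎
    where
    open import Algebra.Solver.CommutativeMonoid +-commutativeMonoid using (solve; _⊕_; _⊜_)
    middle-swap : ∀ a b c d → (a + c) + (b + d) ≈ (a + b) + (c + d)
    middle-swap = solve 4 (λ a b c d → (a ⊕ c) ⊕ (b ⊕ d) ⊜ (a ⊕ b) ⊕ (c ⊕ d)) refl

  +-homo : ∀ i j → fromℤ (i ℤ.+ j) ≈ fromℤ i + fromℤ j
  +-homo (+ m)    (+ n)    = ×-homo-+ 1# m n
  +-homo (+ m)    -[1+ n ] = ⊖-homo m (suc n)
  +-homo -[1+ m ] (+ n)    = trans (⊖-homo n (suc m)) (+-comm _ _)
  +-homo -[1+ m ] -[1+ n ] = begin
    - (suc (suc (m ℕ.+ n)) × 1#)   ≡⟨ ≡.cong (λ k → - (suc k × 1#)) (ℕ.+-suc m n) ⟨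
    - ((suc m ℕ.+ suc n) × 1#)     ≈⟨ -‿cong (×-homo-+ 1# (suc m) (suc n)) ⟩
    - (suc m × 1# + suc n × 1#)    ≈⟨ ⁻¹-∙-comm _ _ ⟨
    - (suc m × 1#) - suc n × 1#    ∎

  ◃-homo⁺ : ∀ n → fromℤ (Sign.+ ℤ.◃ n) ≈ n × 1#
  ◃-homo⁺ zero    = refl
  ◃-homo⁺ (suc n) = refl

  ◃-homo⁻ : ∀ n → fromℤ (Sign.- ℤ.◃ n) ≈ - (n × 1#)
  ◃-homo⁻ zero    = sym -0#≈0#
  ◃-homo⁻ (suc n) = refl

  -x*-y≈x*y : ∀ x y → - x * - y ≈ x * y
  -x*-y≈x*y x y = begin
    - x * - y     ≈⟨ -‿distribˡ-* x (- y) ⟨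
    - (x * - y)   ≈⟨ -‿cong (-‿distribʳ-* x y) ⟨
    - - (x * y)   ≈⟨ -‿involutive _ ⟩
    x * y         ∎

  *-homo : ∀ i j → fromℤ (i ℤ.* j) ≈ fromℤ i * fromℤ j
  *-homo (+ m)    (+ n)    = trans (◃-homo⁺ (m ℕ.* n)) (×1-homo-* m n)
  *-homo (+ m)    -[1+ n ] = trans (◃-homo⁻ (m ℕ.* suc n)) (trans (-‿cong (×1-homo-* m (suc n))) (-‿distribʳ-* _ _))
  *-homo -[1+ m ] (+ n)    = trans (◃-homo⁻ (suc m ℕ.* n)) (trans (-‿cong (×1-homo-* (suc m) n)) (-‿distribˡ-* _ _))
  *-homo -[1+ m ] -[1+ n ] = trans (◃-homo⁺ (suc m ℕ.* suc n)) (trans (×1-homo-* (suc m) (suc n)) (sym (-x*-y≈x*y _ _)))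

  -‿homo : ∀ i → fromℤ (ℤ.- i) ≈ - fromℤ i
  -‿homo (+ zero)  = sym -0#≈0#
  -‿homo (+ suc n) = refl
  -‿homo -[1+ n ]  = sym (-‿involutive _)

  homomorphism : ℤ.+-*-rawRing -Raw-AlmostCommutative⟶ fromCommutativeRing R
  homomorphism = record
    { ⟦_⟧ = fromℤ ; +-homo = +-homo ; *-homo = *-homo ; -‿homo = -‿homo ; 0-homo = refl ; 1-homo = refl }

  fromℤ-≈? : ∀ i j → Maybe (fromℤ i ≈ fromℤ j)
  fromℤ-≈? i j with i ℤ.≟ j
  ... | yes ≡.refl = just refl
  ... | no _       = nothing

  open import Algebra.Solver.Ring ℤ.+-*-rawRing (fromCommutativeRing R) homomorphism fromℤ-≈? public
    using (solve; _:=_; _:+_; _:*_; _:-_; con)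

module Counting where
  open import Data.Nat as ℕ using (zero; suc; _+_; _*_; _≤_; z≤n)
  open import Data.Nat.Properties as ℕ using (+-*-semiring)
  open import Data.Bool using (Bool; true; false; T; _∧_)
  open import Data.Bool.Properties using (∧-identityʳ)
  open import Data.Fin using (Fin; zero; suc; _≟_)
  open import Data.Fin.Properties using (suc-injective)
  open import Data.List using (List; length; allFin; tabulate; filterᵇ)
  open import Data.List.Membership.Propositional using (_∈_)
  open import Data.List.Membership.Propositional.Properties using (∈-filter⁺; ∈-allFin)
  open import Function using (_∘_)
  open import Relation.Binary.PropositionalEquality
  open import Relation.Nullary using (yes; does)
  open import Relation.Nullary.Decidable using (T?; dec-true)
  open import Algebra.Properties.Semiring.Sum +-*-semiring public
    using (sum-syntax; ∑-comm; ∑-distrib-+)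

  indicator : Bool → ℕ
  indicator true  = 1
  indicator false = 0

  count : ∀ {n} → (Fin n → Bool) → ℕ
  count {n} p = ∑[ i < n ] indicator (p i)

  indices : ∀ {n} → (Fin n → Bool) → List (Fin n)
  indices {n} p = filterᵇ p (allFin n)

  ∈-indices : ∀ {n} {p : Fin n → Bool} {i} → p i ≡ true → i ∈ indices p
  ∈-indices {p = p} {i} pᵢ≡true = ∈-filter⁺ (T? ∘ p) (∈-allFin i) (subst T (sym pᵢ≡true) _)

  length-filterᵇ-tabulate : ∀ {A : Set} {n} (p : A → Bool) (f : Fin n → A) →
                            length (filterᵇ p (tabulate f)) ≡ ∑[ i < n ] indicator (p (f i))
  length-filterᵇ-tabulate {n = zero}  p f = refl
  length-filterᵇ-tabulate {n = suc n} p f with p (f zero)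
  ... | true  = cong suc (length-filterᵇ-tabulate p (f ∘ suc))
  ... | false = length-filterᵇ-tabulate p (f ∘ suc)

  length-indices : ∀ {n} (p : Fin n → Bool) → length (indices p) ≡ count p
  length-indices p = length-filterᵇ-tabulate p (λ i → i)

  ∑-mono-≤ : ∀ {n} {f g : Fin n → ℕ} → (∀ i → f i ≤ g i) → ∑[ i < n ] f i ≤ ∑[ i < n ] g i
  ∑-mono-≤ {zero}  f≤g = z≤n
  ∑-mono-≤ {suc n} f≤g = ℕ.+-mono-≤ (f≤g zero) (∑-mono-≤ (f≤g ∘ suc))

  ∑-const : ∀ n c → ∑[ i < n ] c ≡ n * c
  ∑-const zero    c = refl
  ∑-const (suc n) c = cong (c +_) (∑-const n c)

  ∑-single≤ : ∀ {n} (f : Fin n → ℕ) i → f i ≤ ∑[ j < n ] f j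
  ∑-single≤ f zero    = ℕ.m≤m+n (f zero) _
  ∑-single≤ f (suc i) = ℕ.≤-trans (∑-single≤ (f ∘ suc) i) (ℕ.m≤n+m _ (f zero))

  count-none : ∀ {n} {p : Fin n → Bool} → (∀ i → p i ≡ false) → count p ≡ 0
  count-none {zero}  none = refl
  count-none {suc n} none rewrite none zero = count-none (none ∘ suc)

  count≤1 : ∀ {n} (p : Fin n → Bool) → (∀ i j → p i ≡ true → p j ≡ true → i ≡ j) → count p ≤ 1
  count≤1 {zero}  p unique = z≤n
  count≤1 {suc n} p unique with p zero in p₀
  ... | true  = ℕ.≤-reflexive (cong suc (count-none rest-false))
    where
    rest-false : ∀ i → p (suc i) ≡ false
    rest-false i with p (suc i) in pᵢ
    ... | false = refl
    ... | true  with () ← unique zero (suc i) p₀ pᵢ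
  ... | false = count≤1 (p ∘ suc) (λ i j pᵢ pⱼ → suc-injective (unique (suc i) (suc j) pᵢ pⱼ))

  count≤-injective : ∀ {n k} (f : Fin n → Fin k) (p : Fin n → Bool) →
                     (∀ {i j} → p i ≡ true → p j ≡ true → f i ≡ f j → i ≡ j) → count p ≤ k
  count≤-injective {n} {k} f p injective = begin
    ∑[ i < n ] indicator (p i)
      ≤⟨ ∑-mono-≤ (λ i → subst (_≤ ∑[ s < k ] fibre s i) (fibre-image i) (∑-single≤ (λ s → fibre s i) (f i))) ⟩
    ∑[ i < n ] ∑[ s < k ] fibre s i
      ≡⟨ ∑-comm (λ i s → fibre s i) ⟩
    ∑[ s < k ] ∑[ i < n ] fibre s i
      ≤⟨ ∑-mono-≤ (λ s → count≤1 (inFibre s) (fibre-unique s)) ⟩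
    ∑[ s < k ] 1
      ≡⟨ trans (∑-const k 1) (ℕ.*-identityʳ k) ⟩
    k ∎
    where
    open ℕ.≤-Reasoning
    inFibre : Fin k → Fin n → Bool
    inFibre s i = p i ∧ does (f i ≟ s)
    fibre : Fin k → Fin n → ℕ
    fibre s i = indicator (inFibre s i)
    fibre-image : ∀ i → fibre (f i) i ≡ indicator (p i)
    fibre-image i = trans (cong (λ b → indicator (p i ∧ b)) (dec-true (f i ≟ f i) refl))
                          (cong indicator (∧-identityʳ (p i)))
    fibre-unique : ∀ s i j → inFibre s i ≡ true → inFibre s j ≡ true → i ≡ j
    fibre-unique s i j _ _ with p i in pᵢ | p j in pⱼ | f i ≟ s | f j ≟ s
    ... | true | true | yes fᵢ≡s | yes fⱼ≡s = injective pᵢ pⱼ (trans fᵢ≡s (sym fⱼ≡s))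

module Parity where
  open import Data.Nat as ℕ using (zero; suc; _+_; _≤_; _<_; s≤s)
  import Data.Nat.Properties as ℕ
  open import Data.Bool as Bool using (Bool; true; false; _∧_; _xor_)
  open import Data.Bool.Properties
    using (xor-∧-commutativeRing; xor-same; xor-comm; xor-identityʳ; ∧-zeroʳ; ∧-identityʳ; ∧-comm; ∧-assoc; ¬-not)
  open import Data.Fin using (Fin; zero; suc; punchIn; _≟_)
  open import Data.Fin.Properties using (any?; punchInᵢ≢i)
  open import Data.Vec.Functional using (Vector; insertAt; removeAt)
  open import Data.Vec.Functional.Properties using (insertAt-lookup; insertAt-punchIn)
  open import Data.List using (List; []; _∷_; _++_; length; map)
  open import Data.List.Properties using (length-map; length-++)
  open import Data.List.Relation.Unary.All as All using (All; []; _∷_)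
  open import Data.List.Relation.Unary.All.Properties using (map⁻; ++⁻)
  open import Data.Product using (∃; _×_; _,_; proj₁; proj₂)
  open import Function using (_∘_)
  open import Relation.Binary.PropositionalEquality
  open import Relation.Nullary using (Dec; yes; no; does; contradiction)
  open import Relation.Nullary.Decidable using (dec-true; dec-false)
  open Counting using (count; indices; length-indices; ∈-indices)
  open CommutativeRing xor-∧-commutativeRing using (semiring)
  open import Algebra.Properties.Semiring.Sum semiring
    using (sum-syntax; sum-cong-≗; sum-replicate-zero; sum-remove; ∑-comm; ∑-distrib-+; *-distribˡ-sum; *-distribʳ-sum)
  open ≡-Reasoning

  dot : ∀ {n} → Vector Bool n → Vector Bool n → Bool
  dot {n} s v = ∑[ k < n ] (s k ∧ v k)

  ∑-false : ∀ {n} {f : Fin n → Bool} → (∀ k → f k ≡ false) → ∑[ k < n ] f k ≡ false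
  ∑-false {n} f≡false = trans (sum-cong-≗ f≡false) (sum-replicate-zero n)

  ∑-δ : ∀ {n} (j : Fin n) (f : Fin n → Bool) → ∑[ k < n ] (does (j ≟ k) ∧ f k) ≡ f j
  ∑-δ {suc n} j f = begin
    ∑[ k < suc n ] (does (j ≟ k) ∧ f k)
      ≡⟨ sum-remove {i = j} (λ k → does (j ≟ k) ∧ f k) ⟩
    (does (j ≟ j) ∧ f j) xor ∑[ k < n ] (does (j ≟ punchIn j k) ∧ f (punchIn j k))
      ≡⟨ cong₂ (λ b c → (b ∧ f j) xor c) (dec-true (j ≟ j) refl) (∑-false δ-punchIn) ⟩
    f j xor false
      ≡⟨ xor-identityʳ (f j) ⟩
    f j ∎
    where
    δ-punchIn : ∀ k → does (j ≟ punchIn j k) ∧ f (punchIn j k) ≡ false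
    δ-punchIn k = cong (_∧ f (punchIn j k)) (dec-false (j ≟ punchIn j k) (punchInᵢ≢i j k ∘ sym))

  dot-∑ : ∀ {n N} (s : Vector Bool n) (c : Fin N → Bool) (w : Fin N → Vector Bool n) →
          dot s (λ k → ∑[ i < N ] (c i ∧ w i k)) ≡ ∑[ i < N ] (c i ∧ dot s (w i))
  dot-∑ {n} {N} s c w = begin
    ∑[ k < n ] (s k ∧ ∑[ i < N ] (c i ∧ w i k))
      ≡⟨ sum-cong-≗ (λ k → *-distribˡ-sum (s k) (λ i → c i ∧ w i k)) ⟩
    ∑[ k < n ] ∑[ i < N ] (s k ∧ (c i ∧ w i k))
      ≡⟨ ∑-comm (λ k i → s k ∧ (c i ∧ w i k)) ⟩
    ∑[ i < N ] ∑[ k < n ] (s k ∧ (c i ∧ w i k))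
      ≡⟨ sum-cong-≗ (λ i → sum-cong-≗ (λ k → ∧-left-comm (s k) (c i) (w i k))) ⟩
    ∑[ i < N ] ∑[ k < n ] (c i ∧ (s k ∧ w i k))
      ≡⟨ sum-cong-≗ (λ i → *-distribˡ-sum (c i) (λ k → s k ∧ w i k)) ⟨
    ∑[ i < N ] (c i ∧ dot s (w i)) ∎
    where
    ∧-left-comm : ∀ x y z → x ∧ (y ∧ z) ≡ y ∧ (x ∧ z)
    ∧-left-comm false y z = sym (∧-zeroʳ y)
    ∧-left-comm true  y z = refl

  dot-insertAt : ∀ {n} (s : Vector Bool n) j b (v : Vector Bool (suc n)) →
                 dot (insertAt s j b) v ≡ (b ∧ v j) xor dot s (removeAt v j)
  dot-insertAt s j b v = trans (sum-remove {i = j} (λ k → insertAt s j b k ∧ v k))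
    (cong₂ _xor_ (cong (_∧ v j) (insertAt-lookup s j b))
                 (sum-cong-≗ (λ k → cong (_∧ v (punchIn j k)) (insertAt-punchIn s j b k))))

  -- Removes the unknown j from an equation v using a pivot equation c with c j ≡ true.
  eliminate : ∀ {n} → Fin (suc n) → Vector Bool (suc n) → Vector Bool (suc n) → Vector Bool n
  eliminate j c v k = v (punchIn j k) xor (c (punchIn j k) ∧ v j)

  eliminate-pivot : ∀ {n} j (c : Vector Bool (suc n)) → c j ≡ true → ∀ k → eliminate j c c k ≡ false
  eliminate-pivot j c cⱼ≡true k rewrite cⱼ≡true | ∧-identityʳ (c (punchIn j k)) = xor-same (c (punchIn j k))

  dot-eliminate : ∀ {n} (s : Vector Bool n) j (c v : Vector Bool (suc n)) →
                  dot s (eliminate j c v) ≡ (dot s (removeAt c j) ∧ v j) xor dot s (removeAt v j)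
  dot-eliminate {n} s j c v = begin
    dot s (eliminate j c v)
      ≡⟨ sum-cong-≗ (λ k → distribute (s k)) ⟩
    ∑[ k < n ] ((s k ∧ v (punchIn j k)) xor ((s k ∧ c (punchIn j k)) ∧ v j))
      ≡⟨ ∑-distrib-+ (λ k → s k ∧ v (punchIn j k)) (λ k → (s k ∧ c (punchIn j k)) ∧ v j) ⟩
    dot s (removeAt v j) xor ∑[ k < n ] ((s k ∧ c (punchIn j k)) ∧ v j)
      ≡⟨ cong (dot s (removeAt v j) xor_) (*-distribʳ-sum (v j) (λ k → s k ∧ c (punchIn j k))) ⟨
    dot s (removeAt v j) xor (dot s (removeAt c j) ∧ v j)
      ≡⟨ xor-comm (dot s (removeAt v j)) (dot s (removeAt c j) ∧ v j) ⟩
    (dot s (removeAt c j) ∧ v j) xor dot s (removeAt v j) ∎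
    where
    distribute : ∀ {x y z} s → s ∧ (x xor (y ∧ z)) ≡ (s ∧ x) xor ((s ∧ y) ∧ z)
    distribute false = refl
    distribute true  = refl

  Nonzero : ∀ {n} → Vector Bool n → Set
  Nonzero s = ∃ λ j → s j ≡ true

  Orthogonal : ∀ {n} → Vector Bool n → List (Vector Bool n) → Set
  Orthogonal s vs = All (λ v → dot s v ≡ false) vs

  nonzero-orthogonal : ∀ {n} (vs : List (Vector Bool n)) → length vs < n →
                       ∃ λ s → Nonzero s × Orthogonal s vs
  nonzero-orthogonal-pivot : ∀ {n} c (vs : List (Vector Bool n)) → length (c ∷ vs) < n →
                             Dec (Nonzero c) → ∃ λ s → Nonzero s × Orthogonal s (c ∷ vs)

  nonzero-orthogonal {suc n} []       _         = (λ _ → true) , (zero , refl) , []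
  nonzero-orthogonal         (c ∷ vs) |c∷vs|<n =
    nonzero-orthogonal-pivot c vs |c∷vs|<n (any? λ j → c j Bool.≟ true)

  nonzero-orthogonal-pivot c vs (s≤s |vs|<n) (no c≢0) =
    let s , nonzero , ⊥vs = nonzero-orthogonal vs (ℕ.m≤n⇒m≤1+n |vs|<n)
    in  s , nonzero , ∑-false (λ k → trans (cong (s k ∧_) (¬-not (λ cₖ → c≢0 (k , cₖ)))) (∧-zeroʳ (s k))) ∷ ⊥vs
  nonzero-orthogonal-pivot {suc n} c vs (s≤s |vs|<n) (yes (j , cⱼ≡true)) =
    let s′ , (k , s′ₖ≡true) , ⊥vs′ = nonzero-orthogonal (map (eliminate j c) vs)
                                       (subst (_< n) (sym (length-map (eliminate j c) vs)) |vs|<n)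
        s = insertAt s′ j (dot s′ (removeAt c j))
        dot-lift : ∀ v → dot s v ≡ dot s′ (eliminate j c v)
        dot-lift v = trans (dot-insertAt s′ j _ v) (sym (dot-eliminate s′ j c v))
        ⊥c = trans (dot-lift c) (∑-false (λ k → trans (cong (s′ k ∧_) (eliminate-pivot j c cⱼ≡true k)) (∧-zeroʳ (s′ k))))
    in  s , (punchIn j k , trans (insertAt-punchIn s′ j _ k) s′ₖ≡true) ,
        ⊥c ∷ All.map (λ {v} ⊥v → trans (dot-lift v) ⊥v) (map⁻ ⊥vs′)

  -- Cell (t , u) of the grid lies in part g t u, part i is the rectangle a₁ i × a₂ i, and V is a
  -- set of parts covering every off-diagonal cell.
  module RectangleCover {N Q} (g : Fin Q → Fin Q → Fin N) (a₁ a₂ : Fin N → Fin Q → Bool)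
                        (rectangular : ∀ i t u → a₁ i t ∧ a₂ i u ≡ does (g t u ≟ i))
                        (V : Fin N → Bool) (covers-off-diagonal : ∀ {t u} → t ≢ u → V (g t u) ≡ true) where

    covered-diagonal : Fin Q → Bool
    covered-diagonal t = V (g t t)

    row-sum-rectangles : ∀ s j → dot s (λ k → V (g j k)) ≡ ∑[ i < N ] ((a₁ i j ∧ V i) ∧ dot s (a₂ i))
    row-sum-rectangles s j = begin
      dot s (λ k → V (g j k))                              ≡⟨ sum-cong-≗ (λ k → cong (s k ∧_) (V-rectangles k)) ⟩
      dot s (λ k → ∑[ i < N ] ((a₁ i j ∧ V i) ∧ a₂ i k))   ≡⟨ dot-∑ s (λ i → a₁ i j ∧ V i) a₂ ⟩
      ∑[ i < N ] ((a₁ i j ∧ V i) ∧ dot s (a₂ i))           ∎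
      where
      ∧-right-comm : ∀ x y z → (x ∧ y) ∧ z ≡ (x ∧ z) ∧ y
      ∧-right-comm x y z = trans (∧-assoc x y z) (trans (cong (x ∧_) (∧-comm y z)) (sym (∧-assoc x z y)))
      V-rectangles : ∀ k → V (g j k) ≡ ∑[ i < N ] ((a₁ i j ∧ V i) ∧ a₂ i k)
      V-rectangles k = begin
        V (g j k)                              ≡⟨ ∑-δ (g j k) V ⟨
        ∑[ i < N ] (does (g j k ≟ i) ∧ V i)    ≡⟨ sum-cong-≗ (λ i → cong (_∧ V i) (rectangular i j k)) ⟨
        ∑[ i < N ] ((a₁ i j ∧ a₂ i k) ∧ V i)   ≡⟨ sum-cong-≗ (λ i → ∧-right-comm (a₁ i j) (a₂ i k) (V i)) ⟩
        ∑[ i < N ] ((a₁ i j ∧ V i) ∧ a₂ i k)   ∎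

    row-sum-off-diagonal : ∀ s j → covered-diagonal j ≡ false → dot s (λ k → V (g j k)) ≡ ∑[ k < Q ] s k xor s j
    row-sum-off-diagonal s j diagonalⱼ≡false = begin
      dot s (λ k → V (g j k))                             ≡⟨ sum-cong-≗ off-diagonal ⟩
      ∑[ k < Q ] (s k xor (does (j ≟ k) ∧ s k))           ≡⟨ ∑-distrib-+ s (λ k → does (j ≟ k) ∧ s k) ⟩
      ∑[ k < Q ] s k xor ∑[ k < Q ] (does (j ≟ k) ∧ s k)  ≡⟨ cong (∑[ k < Q ] s k xor_) (∑-δ j s) ⟩
      ∑[ k < Q ] s k xor s j                              ∎
      where
      off-diagonal : ∀ k → s k ∧ V (g j k) ≡ s k xor (does (j ≟ k) ∧ s k)
      off-diagonal k with j ≟ k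
      ... | yes refl = trans (cong (s j ∧_) diagonalⱼ≡false) (trans (∧-zeroʳ (s j)) (sym (xor-same (s j))))
      ... | no j≢k   = trans (cong (s k ∧_) (covers-off-diagonal j≢k))
                             (trans (∧-identityʳ (s k)) (sym (xor-identityʳ (s k))))

    record Annihilator : Set where
      field
        s                  : Vector Bool Q
        j                  : Fin Q
        sⱼ≡true            : s j ≡ true
        even               : ∑[ k < Q ] s k ≡ false
        ⊥a₂                : ∀ {i} → V i ≡ true → dot s (a₂ i) ≡ false
        vanishes-diagonal  : ∀ {t} → covered-diagonal t ≡ true → s t ≡ false

    annihilator : suc (count V + count covered-diagonal) < Q → Annihilator
    annihilator few = record
      { s = s ; j = j ; sⱼ≡true = sⱼ≡true
      ; even = trans (sum-cong-≗ (λ k → sym (∧-identityʳ (s k)))) (All.head ⊥constraints)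
      ; ⊥a₂ = λ Vᵢ → All.lookup (map⁻ (proj₁ ⊥a₂s×⊥units)) (∈-indices {p = V} Vᵢ)
      ; vanishes-diagonal = λ {t} Dₜ → begin
          s t                               ≡⟨ ∑-δ t s ⟨
          ∑[ k < Q ] (does (t ≟ k) ∧ s k)   ≡⟨ sum-cong-≗ (λ k → ∧-comm (does (t ≟ k)) (s k)) ⟩
          dot s (unit t)                    ≡⟨ All.lookup (map⁻ (proj₂ ⊥a₂s×⊥units)) (∈-indices {p = covered-diagonal} Dₜ) ⟩
          false                             ∎
      }
      where
      unit : Fin Q → Vector Bool Q
      unit t k = does (t ≟ k)

      constraints : List (Vector Bool Q)
      constraints = (λ _ → true) ∷ (map a₂ (indices V) ++ map unit (indices covered-diagonal))

      |constraints|<Q : length constraints < Q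
      |constraints|<Q = subst (λ n → suc n < Q) (sym (begin
        length (map a₂ (indices V) ++ map unit (indices covered-diagonal))
          ≡⟨ length-++ (map a₂ (indices V)) ⟩
        length (map a₂ (indices V)) + length (map unit (indices covered-diagonal))
          ≡⟨ cong₂ _+_ (length-map a₂ (indices V)) (length-map unit (indices covered-diagonal)) ⟩
        length (indices V) + length (indices covered-diagonal)
          ≡⟨ cong₂ _+_ (length-indices V) (length-indices covered-diagonal) ⟩
        count V + count covered-diagonal ∎)) few

      solution = nonzero-orthogonal constraints |constraints|<Q
      s = proj₁ solution
      j = proj₁ (proj₁ (proj₂ solution))
      sⱼ≡true = proj₂ (proj₁ (proj₂ solution))
      ⊥constraints = proj₂ (proj₂ solution)
      ⊥a₂s×⊥units = ++⁻ (map a₂ (indices V)) (All.tail ⊥constraints)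

    -- Against an annihilator s, row j of V ∘ g sums to ∑ s + s j = 1 by the off-diagonal cover,
    -- but to 0 through the rectangles a₁ i × a₂ i.
    rectangle-bound : Q ≤ suc (count V + count covered-diagonal)
    rectangle-bound with Q ℕ.≤? suc (count V + count covered-diagonal)
    ... | yes Q≤ = Q≤
    ... | no Q≰ = contradiction (begin
        true                                        ≡⟨ sⱼ≡true ⟨
        false xor s j                               ≡⟨ cong (_xor s j) even ⟨
        ∑[ k < Q ] s k xor s j                      ≡⟨ row-sum-off-diagonal s j diagonalⱼ≡false ⟨
        dot s (λ k → V (g j k))                     ≡⟨ row-sum-rectangles s j ⟩
        ∑[ i < N ] ((a₁ i j ∧ V i) ∧ dot s (a₂ i))  ≡⟨ ∑-false term≡false ⟩
        false                                       ∎) λ ()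
      where
      open Annihilator (annihilator (ℕ.≰⇒> Q≰))
      diagonalⱼ≡false : covered-diagonal j ≡ false
      diagonalⱼ≡false = ¬-not λ Dⱼ → contradiction (trans (sym sⱼ≡true) (vanishes-diagonal Dⱼ)) λ ()
      term≡false : ∀ i → (a₁ i j ∧ V i) ∧ dot s (a₂ i) ≡ false
      term≡false i with V i in Vᵢ
      ... | true  = trans (cong ((a₁ i j ∧ true) ∧_) (⊥a₂ Vᵢ)) (∧-zeroʳ _)
      ... | false = cong (_∧ dot s (a₂ i)) (∧-zeroʳ (a₁ i j))

module Geometry {q : ℕ} (F : FiniteField q) where
  open import Level using (0ℓ)
  open import Data.Integer using (+_)
  open import Data.Product using (∃₂; _×_; _,_; proj₁; proj₂)
  open import Relation.Binary.PropositionalEquality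
  open FiniteField F

  commutativeRing : CommutativeRing 0ℓ 0ℓ
  commutativeRing = record { isCommutativeRing = isCommutativeRing }

  open CommutativeRing commutativeRing public using (_-_; zeroˡ; +-identityˡ)
  open IntegerCoefficients commutativeRing public using (solve; _:=_; _:+_; _:*_; _:-_; con)
  open ≡-Reasoning

  x*y≡0⇒y≡0 : ∀ {x y} → x ≢ 0# → x * y ≡ 0# → y ≡ 0#
  x*y≡0⇒y≡0 {x} {y} x≢0 xy≡0 with inverse x x≢0
  ... | x⁻¹ , xx⁻¹≡1 = begin
    y              ≡⟨ solve 1 (λ y → y := y :* con (+ 1)) refl y ⟩
    y * 1#         ≡⟨ cong (y *_) xx⁻¹≡1 ⟨
    y * (x * x⁻¹)  ≡⟨ solve 3 (λ x y x⁻¹ → y :* (x :* x⁻¹) := (x :* y) :* x⁻¹) refl x y x⁻¹ ⟩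
    (x * y) * x⁻¹  ≡⟨ cong (_* x⁻¹) xy≡0 ⟩
    0# * x⁻¹       ≡⟨ zeroˡ x⁻¹ ⟩
    0#             ∎

  x-y≡0⇒x≡y : ∀ {x y} → x - y ≡ 0# → x ≡ y
  x-y≡0⇒x≡y {x} {y} x-y≡0 = begin
    x            ≡⟨ solve 2 (λ x y → x := (x :- y) :+ y) refl x y ⟩
    (x - y) + y  ≡⟨ cong (_+ y) x-y≡0 ⟩
    0# + y       ≡⟨ +-identityˡ y ⟩
    y            ∎

  x≢y⇒x-y≢0 : ∀ {x y} → x ≢ y → x - y ≢ 0#
  x≢y⇒x-y≢0 x≢y x-y≡0 = x≢y (x-y≡0⇒x≡y x-y≡0)

  affine-unique : ∀ {t u m b m′ b′} → t ≢ u → m * t + b ≡ m′ * t + b′ → m * u + b ≡ m′ * u + b′ →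
                  m ≡ m′ × b ≡ b′
  affine-unique {t} {u} {m} {b} {m′} {b′} t≢u agree-t agree-u = m≡m′ , b≡b′
    where
    [t-u][m-m′]≡0 : (t - u) * (m - m′) ≡ 0#
    [t-u][m-m′]≡0 = begin
      (t - u) * (m - m′)
        ≡⟨ solve 6 (λ t u m b m′ b′ → (t :- u) :* (m :- m′)
                     := ((m :* t :+ b) :- (m′ :* t :+ b′)) :- ((m :* u :+ b) :- (m′ :* u :+ b′))) refl t u m b m′ b′ ⟩
      ((m * t + b) - (m′ * t + b′)) - ((m * u + b) - (m′ * u + b′))
        ≡⟨ cong₂ (λ x y → (x - (m′ * t + b′)) - (y - (m′ * u + b′))) agree-t agree-u ⟩
      ((m′ * t + b′) - (m′ * t + b′)) - ((m′ * u + b′) - (m′ * u + b′))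
        ≡⟨ solve 2 (λ x y → (x :- x) :- (y :- y) := con (+ 0)) refl (m′ * t + b′) (m′ * u + b′) ⟩
      0# ∎
    m≡m′ : m ≡ m′
    m≡m′ = x-y≡0⇒x≡y (x*y≡0⇒y≡0 (x≢y⇒x-y≢0 t≢u) [t-u][m-m′]≡0)
    b≡b′ : b ≡ b′
    b≡b′ = begin
      b                       ≡⟨ solve 2 (λ x b → b := (x :+ b) :- x) refl (m * t) b ⟩
      (m * t + b) - m * t     ≡⟨ cong₂ (λ x y → x - y * t) agree-t m≡m′ ⟩
      (m′ * t + b′) - m′ * t  ≡⟨ solve 2 (λ x b → (x :+ b) :- x := b) refl (m′ * t) b′ ⟩
      b′                      ∎

  cramer-zero : ∀ {l₁ k₁ l₂ k₂ x y} → l₁ * k₂ - l₂ * k₁ ≢ 0# →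
                l₁ * x + k₁ * y ≡ 0# → l₂ * x + k₂ * y ≡ 0# → x ≡ 0# × y ≡ 0#
  cramer-zero {l₁} {k₁} {l₂} {k₂} {x} {y} det≢0 e₁ e₂ = x*y≡0⇒y≡0 det≢0 det*x≡0 , x*y≡0⇒y≡0 det≢0 det*y≡0
    where
    a*0-b*0≡0 : ∀ a b → a * 0# - b * 0# ≡ 0#
    a*0-b*0≡0 = solve 2 (λ a b → a :* con (+ 0) :- b :* con (+ 0) := con (+ 0)) refl
    det*x≡0 : (l₁ * k₂ - l₂ * k₁) * x ≡ 0#
    det*x≡0 = begin
      (l₁ * k₂ - l₂ * k₁) * x
        ≡⟨ solve 6 (λ l₁ k₁ l₂ k₂ x y → (l₁ :* k₂ :- l₂ :* k₁) :* x
                     := k₂ :* (l₁ :* x :+ k₁ :* y) :- k₁ :* (l₂ :* x :+ k₂ :* y)) refl l₁ k₁ l₂ k₂ x y ⟩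
      k₂ * (l₁ * x + k₁ * y) - k₁ * (l₂ * x + k₂ * y)  ≡⟨ cong₂ (λ a b → k₂ * a - k₁ * b) e₁ e₂ ⟩
      k₂ * 0# - k₁ * 0#                                ≡⟨ a*0-b*0≡0 k₂ k₁ ⟩
      0#                                               ∎
    det*y≡0 : (l₁ * k₂ - l₂ * k₁) * y ≡ 0#
    det*y≡0 = begin
      (l₁ * k₂ - l₂ * k₁) * y
        ≡⟨ solve 6 (λ l₁ k₁ l₂ k₂ x y → (l₁ :* k₂ :- l₂ :* k₁) :* y
                     := l₁ :* (l₂ :* x :+ k₂ :* y) :- l₂ :* (l₁ :* x :+ k₁ :* y)) refl l₁ k₁ l₂ k₂ x y ⟩
      l₁ * (l₂ * x + k₂ * y) - l₂ * (l₁ * x + k₁ * y)  ≡⟨ cong₂ (λ a b → l₁ * a - l₂ * b) e₂ e₁ ⟩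
      l₁ * 0# - l₂ * 0#                                ≡⟨ a*0-b*0≡0 l₁ l₂ ⟩
      0#                                               ∎

  K³ : Set
  K³ = K F × K F × K F

  lincomb : K F → K F → K³ → K³ → K³
  lincomb l k (u₀ , u₁ , u₂) (v₀ , v₁ , v₂) = l * u₀ + k * v₀ , l * u₁ + k * v₁ , l * u₂ + k * v₂

  InSpan⇒lincomb : ∀ P Q v → InSpan F P Q v → ∃₂ λ l k → v ≡ lincomb l k (coords F P) (coords F Q)
  InSpan⇒lincomb _ _ (x₀ , x₁ , x₂) (l , k , e₀ , e₁ , e₂) = l , k , cong₂ _,_ e₀ (cong₂ _,_ e₁ e₂)

  minor₀₁ : K³ → K³ → K F
  minor₀₁ (a₀ , a₁ , _) (b₀ , b₁ , _) = a₀ * b₁ - a₁ * b₀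

  minor₀₁-lincomb : ∀ l₁ k₁ l₂ k₂ u v →
                    minor₀₁ (lincomb l₁ k₁ u v) (lincomb l₂ k₂ u v) ≡ (l₁ * k₂ - l₂ * k₁) * minor₀₁ u v
  minor₀₁-lincomb l₁ k₁ l₂ k₂ (u₀ , u₁ , _) (v₀ , v₁ , _) =
    solve 8 (λ l₁ k₁ l₂ k₂ u₀ u₁ v₀ v₁ →
      (l₁ :* u₀ :+ k₁ :* v₀) :* (l₂ :* u₁ :+ k₂ :* v₁) :- (l₁ :* u₁ :+ k₁ :* v₁) :* (l₂ :* u₀ :+ k₂ :* v₀)
      := (l₁ :* k₂ :- l₂ :* k₁) :* (u₀ :* v₁ :- u₁ :* v₀)) refl l₁ k₁ l₂ k₂ u₀ u₁ v₀ v₁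

  -- The linear form whose zero set in the affine chart is the graph of t ↦ m t + b.
  affineForm : K F → K F → K³ → K F
  affineForm m b (x₀ , x₁ , x₂) = x₂ - (m * x₁ + b * x₀)

  affineForm-lincomb : ∀ m b l k u v →
                       affineForm m b (lincomb l k u v) ≡ l * affineForm m b u + k * affineForm m b v
  affineForm-lincomb m b l k (u₀ , u₁ , u₂) (v₀ , v₁ , v₂) =
    solve 10 (λ m b l k u₀ u₁ u₂ v₀ v₁ v₂ →
      (l :* u₂ :+ k :* v₂) :- (m :* (l :* u₁ :+ k :* v₁) :+ b :* (l :* u₀ :+ k :* v₀))
      := l :* (u₂ :- (m :* u₁ :+ b :* u₀)) :+ k :* (v₂ :- (m :* v₁ :+ b :* v₀))) refl m b l k u₀ u₁ u₂ v₀ v₁ v₂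

  graphPoint : K F → K F → K F → Point F
  graphPoint m b t = pt₁ t (m * t + b)

  affineForm-graphPoint : ∀ m b t → affineForm m b (coords F (graphPoint m b t)) ≡ 0#
  affineForm-graphPoint = solve 3 (λ m b t → (m :* t :+ b) :- (m :* t :+ b :* con (+ 1)) := con (+ 0)) refl

  affineForm≡0⇒onGraph : ∀ {m b r s} → affineForm m b (coords F (pt₁ r s)) ≡ 0# → s ≡ m * r + b
  affineForm≡0⇒onGraph {m} {b} {r} φ≡0 =
    trans (x-y≡0⇒x≡y φ≡0) (solve 3 (λ m b r → m :* r :+ b :* con (+ 1) := m :* r :+ b) refl m b r)

  -- The form φ vanishes at two independent vectors of the plane of L, hence on all of it.
  onLine-graph : ∀ (L : Line F) {m b t u r s} → t ≢ u →
                 OnLine F L (graphPoint m b t) → OnLine F L (graphPoint m b u) →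
                 OnLine F L (pt₁ r s) → s ≡ m * r + b
  onLine-graph L {m} {b} {t} {u} {r} {s} t≢u onT onU onR
    with InSpan⇒lincomb (Line.P L) (Line.Q L) _ onT | InSpan⇒lincomb (Line.P L) (Line.Q L) _ onU
       | InSpan⇒lincomb (Line.P L) (Line.Q L) _ onR
  ... | l₁ , k₁ , T≡ | l₂ , k₂ , U≡ | l₃ , k₃ , R≡ = affineForm≡0⇒onGraph φR≡0
    where
    P = coords F (Line.P L)
    Q = coords F (Line.Q L)
    φ = affineForm m b

    φ-on-span : ∀ {x l k} → x ≡ lincomb l k P Q → φ x ≡ 0# → l * φ P + k * φ Q ≡ 0#
    φ-on-span {x} {l} {k} x≡ φx≡0 = trans (sym (affineForm-lincomb m b l k P Q)) (trans (cong φ (sym x≡)) φx≡0)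

    det≢0 : l₁ * k₂ - l₂ * k₁ ≢ 0#
    det≢0 det≡0 = x≢y⇒x-y≢0 (λ u≡t → t≢u (sym u≡t)) (begin
      u - t
        ≡⟨ solve 2 (λ t u → u :- t := con (+ 1) :* u :- t :* con (+ 1)) refl t u ⟩
      minor₀₁ (coords F (graphPoint m b t)) (coords F (graphPoint m b u))
        ≡⟨ cong₂ minor₀₁ T≡ U≡ ⟩
      minor₀₁ (lincomb l₁ k₁ P Q) (lincomb l₂ k₂ P Q)
        ≡⟨ minor₀₁-lincomb l₁ k₁ l₂ k₂ P Q ⟩
      (l₁ * k₂ - l₂ * k₁) * minor₀₁ P Q
        ≡⟨ cong (_* minor₀₁ P Q) det≡0 ⟩
      0# * minor₀₁ P Q
        ≡⟨ zeroˡ _ ⟩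
      0# ∎)

    φP≡0×φQ≡0 : φ P ≡ 0# × φ Q ≡ 0#
    φP≡0×φQ≡0 = cramer-zero det≢0 (φ-on-span T≡ (affineForm-graphPoint m b t))
                                  (φ-on-span U≡ (affineForm-graphPoint m b u))

    φR≡0 : φ (coords F (pt₁ r s)) ≡ 0#
    φR≡0 = begin
      φ (coords F (pt₁ r s))  ≡⟨ cong φ R≡ ⟩
      φ (lincomb l₃ k₃ P Q)   ≡⟨ affineForm-lincomb m b l₃ k₃ P Q ⟩
      l₃ * φ P + k₃ * φ Q     ≡⟨ cong₂ (λ x y → l₃ * x + k₃ * y) (proj₁ φP≡0×φQ≡0) (proj₂ φP≡0×φQ≡0) ⟩
      l₃ * 0# + k₃ * 0#       ≡⟨ solve 2 (λ a b → a :* con (+ 0) :+ b :* con (+ 0) := con (+ 0)) refl l₃ k₃ ⟩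
      0#                      ∎

module UpperBound {q : ℕ} (F : FiniteField q) where
  open import Data.Nat as ℕ using (suc)
  open import Data.Fin using (Fin; zero; suc; _≟_)
  open import Data.Fin.Properties using (+↔⊎; *↔×)
  open import Data.Integer using (+_)
  open import Data.Product using (_×_; _,_; proj₁; proj₂)
  open import Data.Product.Function.NonDependent.Propositional using (_×-↔_)
  open import Data.Sum using (_⊎_; inj₁; inj₂)
  open import Data.Sum.Function.Propositional using (_⊎-↔_)
  open import Function using (_↔_; Inverse; mk↔ₛ′)
  open import Function.Properties.Inverse using (↔-refl; ↔-sym; ↔-trans)
  open import Relation.Binary.PropositionalEquality
  open import Relation.Nullary using (yes; no)
  open FiniteField F
  open Geometry F
  open ≡-Reasoning

  Direction : Set
  Direction = Fin (suc q)

  -- The q + 1 lines through x are indexed by Direction: secondPoint x d is a point other than x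
  -- on the d-th of them, and direction x y is the index of a line through x and y.
  secondPoint : Point F → Direction → Point F
  secondPoint (pt₁ a b) zero    = pt₃
  secondPoint (pt₁ a b) (suc s) = pt₂ s
  secondPoint (pt₂ s)   zero    = pt₃
  secondPoint (pt₂ s)   (suc c) = pt₁ 0# c
  secondPoint pt₃       zero    = pt₂ 0#
  secondPoint pt₃       (suc a) = pt₁ a 0#

  direction : Point F → Point F → Direction
  direction (pt₁ a b) (pt₁ a′ b′) with a′ ≟ a
  ... | yes _    = zero
  ... | no a′≢a  = suc ((b′ - b) * proj₁ (inverse (a′ - a) (x≢y⇒x-y≢0 a′≢a)))
  direction (pt₁ a b) (pt₂ s)     = suc s
  direction (pt₁ a b) pt₃         = zero
  direction (pt₂ s)   (pt₁ a′ b′) = suc (b′ - s * a′)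
  direction (pt₂ s)   (pt₂ _)     = zero
  direction (pt₂ s)   pt₃         = zero
  direction pt₃       (pt₁ a′ b′) = suc a′
  direction pt₃       (pt₂ _)     = zero
  direction pt₃       pt₃         = zero

  secondPoint≢ : ∀ x d → x ≢ secondPoint x d
  secondPoint≢ (pt₁ a b) zero    ()
  secondPoint≢ (pt₁ a b) (suc s) ()
  secondPoint≢ (pt₂ s)   zero    ()
  secondPoint≢ (pt₂ s)   (suc c) ()
  secondPoint≢ pt₃       zero    ()
  secondPoint≢ pt₃       (suc a) ()

  direction-secondPoint : ∀ x d → direction x (secondPoint x d) ≡ d
  direction-secondPoint (pt₁ a b) zero    = refl
  direction-secondPoint (pt₁ a b) (suc s) = refl
  direction-secondPoint (pt₂ s)   zero    = refl
  direction-secondPoint (pt₂ s)   (suc c) = cong suc (solve 2 (λ c s → c :- s :* con (+ 0) := c) refl c s)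
  direction-secondPoint pt₃       zero    = refl
  direction-secondPoint pt₃       (suc a) = refl

  lineThrough : Point F → Direction → Line F
  lineThrough x d = line x (secondPoint x d) (secondPoint≢ x d)

  onLine-first : ∀ P Q (P≢Q : P ≢ Q) → OnLine F (line P Q P≢Q) P
  onLine-first P Q _ = 1# , 0# , x≡1x+0y _ _ , x≡1x+0y _ _ , x≡1x+0y _ _
    where
    x≡1x+0y : ∀ x y → x ≡ 1# * x + 0# * y
    x≡1x+0y = solve 2 (λ x y → x := con (+ 1) :* x :+ con (+ 0) :* y) refl

  onLine-second : ∀ P Q (P≢Q : P ≢ Q) → OnLine F (line P Q P≢Q) Q
  onLine-second P Q _ = 0# , 1# , y≡0x+1y _ _ , y≡0x+1y _ _ , y≡0x+1y _ _
    where
    y≡0x+1y : ∀ x y → y ≡ 0# * x + 1# * y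
    y≡0x+1y = solve 2 (λ x y → y := con (+ 0) :* x :+ con (+ 1) :* y) refl

  onLine-direction : ∀ x y → OnLine F (lineThrough x (direction x y)) y
  onLine-direction (pt₁ a b) (pt₁ a′ b′) with a′ ≟ a
  ... | yes a′≡a = 1# , b′ - b ,
    solve 1 (λ d → con (+ 1) := con (+ 1) :* con (+ 1) :+ d :* con (+ 0)) refl (b′ - b) ,
    trans a′≡a (solve 2 (λ a d → a := con (+ 1) :* a :+ d :* con (+ 0)) refl a (b′ - b)) ,
    solve 2 (λ b b′ → b′ := con (+ 1) :* b :+ (b′ :- b) :* con (+ 1)) refl b b′
  ... | no a′≢a with inverse (a′ - a) (x≢y⇒x-y≢0 a′≢a)
  ... | w , [a′-a]w≡1 = 1# , a′ - a ,
    solve 1 (λ d → con (+ 1) := con (+ 1) :* con (+ 1) :+ d :* con (+ 0)) refl (a′ - a) ,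
    solve 2 (λ a a′ → a′ := con (+ 1) :* a :+ (a′ :- a) :* con (+ 1)) refl a a′ ,
    (begin
      b′                                     ≡⟨ solve 2 (λ b b′ → b′ := con (+ 1) :* b :+ (b′ :- b) :* con (+ 1)) refl b b′ ⟩
      1# * b + (b′ - b) * 1#                 ≡⟨ cong (λ z → 1# * b + (b′ - b) * z) [a′-a]w≡1 ⟨
      1# * b + (b′ - b) * ((a′ - a) * w)     ≡⟨ solve 4 (λ b d e w → con (+ 1) :* b :+ d :* (e :* w) := con (+ 1) :* b :+ e :* (d :* w))
                                                   refl b (b′ - b) (a′ - a) w ⟩
      1# * b + (a′ - a) * ((b′ - b) * w)     ∎)
  onLine-direction (pt₁ a b) (pt₂ s)     = onLine-second (pt₁ a b) (pt₂ s) λ ()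
  onLine-direction (pt₁ a b) pt₃         = onLine-second (pt₁ a b) pt₃ λ ()
  onLine-direction (pt₂ s)   (pt₁ a′ b′) = a′ , 1# ,
    solve 1 (λ a → con (+ 1) := a :* con (+ 0) :+ con (+ 1) :* con (+ 1)) refl a′ ,
    solve 1 (λ a → a := a :* con (+ 1) :+ con (+ 1) :* con (+ 0)) refl a′ ,
    solve 3 (λ a b s → b := a :* s :+ con (+ 1) :* (b :- s :* a)) refl a′ b′ s
  onLine-direction (pt₂ s)   (pt₂ s′)    = 1# , s′ - s ,
    solve 1 (λ d → con (+ 0) := con (+ 1) :* con (+ 0) :+ d :* con (+ 0)) refl (s′ - s) ,
    solve 1 (λ d → con (+ 1) := con (+ 1) :* con (+ 1) :+ d :* con (+ 0)) refl (s′ - s) ,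
    solve 2 (λ s s′ → s′ := con (+ 1) :* s :+ (s′ :- s) :* con (+ 1)) refl s s′
  onLine-direction (pt₂ s)   pt₃         = onLine-second (pt₂ s) pt₃ λ ()
  onLine-direction pt₃       (pt₁ a′ b′) = b′ , 1# ,
    solve 1 (λ b → con (+ 1) := b :* con (+ 0) :+ con (+ 1) :* con (+ 1)) refl b′ ,
    solve 2 (λ a b → a := b :* con (+ 0) :+ con (+ 1) :* a) refl a′ b′ ,
    solve 1 (λ b → b := b :* con (+ 1) :+ con (+ 1) :* con (+ 0)) refl b′
  onLine-direction pt₃       (pt₂ s)     = s , 1# ,
    solve 1 (λ s → con (+ 0) := s :* con (+ 0) :+ con (+ 1) :* con (+ 0)) refl s ,
    solve 1 (λ s → con (+ 1) := s :* con (+ 0) :+ con (+ 1) :* con (+ 1)) refl s ,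
    solve 1 (λ s → s := s :* con (+ 1) :+ con (+ 1) :* con (+ 0)) refl s
  onLine-direction pt₃       pt₃         = onLine-first pt₃ (pt₂ 0#) λ ()

  Point↔⊎ : Point F ↔ ((Fin q × Fin q) ⊎ Fin (suc q))
  Point↔⊎ = mk↔ₛ′ to from to∘from from∘to
    where
    to : Point F → (Fin q × Fin q) ⊎ Fin (suc q)
    to (pt₁ a b) = inj₁ (a , b)
    to (pt₂ s)   = inj₂ (suc s)
    to pt₃       = inj₂ zero
    from : (Fin q × Fin q) ⊎ Fin (suc q) → Point F
    from (inj₁ (a , b)) = pt₁ a b
    from (inj₂ (suc s)) = pt₂ s
    from (inj₂ zero)    = pt₃
    to∘from : ∀ y → to (from y) ≡ y
    to∘from (inj₁ _)       = refl
    to∘from (inj₂ (suc _)) = refl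
    to∘from (inj₂ zero)    = refl
    from∘to : ∀ x → from (to x) ≡ x
    from∘to (pt₁ _ _) = refl
    from∘to (pt₂ _)   = refl
    from∘to pt₃       = refl

  #points : ℕ
  #points = q ℕ.* q ℕ.+ suc q

  #parts : ℕ
  #parts = #points ℕ.* suc q

  Part↔Fin : (Point F × Direction) ↔ Fin #parts
  Part↔Fin = ↔-trans (↔-trans Point↔⊎ (↔-sym (↔-trans +↔⊎ (*↔× ⊎-↔ ↔-refl))) ×-↔ ↔-refl) (↔-sym *↔×)

  open Inverse Part↔Fin using (to; from; strictlyInverseˡ; strictlyInverseʳ)

  base : Fin #parts → Point F
  base i = proj₁ (from i)

  slot : Fin #parts → Direction
  slot i = proj₂ (from i)

  linePartition : LinePartition F #parts
  linePartition = record
    { A₁       = λ i x → base i ≡ x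
    ; A₂       = λ i y → direction (base i) y ≡ slot i
    ; covers   = λ x y → to (x , direction x y) , cong proj₁ (strictlyInverseʳ (x , direction x y)) ,
                   subst (λ p → direction (proj₁ p) y ≡ proj₂ p) (sym (strictlyInverseʳ (x , direction x y))) refl
    ; disjoint = λ x y i j (baseᵢ≡x , slotᵢ) (baseⱼ≡x , slotⱼ) →
                   same-part y i j (trans baseᵢ≡x (sym baseⱼ≡x)) slotᵢ slotⱼ
    ; nonempty = λ i → base i , secondPoint (base i) (slot i) , refl , direction-secondPoint (base i) (slot i)
    ; inLine   = λ i → lineThrough (base i) (slot i) , λ x y baseᵢ≡x slotᵢ →
                   subst (OnLine F (lineThrough (base i) (slot i))) baseᵢ≡x
                     (onLine-first (base i) (secondPoint (base i) (slot i)) (secondPoint≢ (base i) (slot i))) ,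
                   subst (λ d → OnLine F (lineThrough (base i) d) y) slotᵢ (onLine-direction (base i) y)
    }
    where
    same-part : ∀ y i j → base i ≡ base j → direction (base i) y ≡ slot i → direction (base j) y ≡ slot j → i ≡ j
    same-part y i j baseᵢ≡baseⱼ slotᵢ slotⱼ = begin
      i            ≡⟨ strictlyInverseˡ i ⟨
      to (from i)  ≡⟨ cong to (cong₂ _,_ baseᵢ≡baseⱼ slotᵢ≡slotⱼ) ⟩
      to (from j)  ≡⟨ strictlyInverseˡ j ⟩
      j            ∎
      where
      slotᵢ≡slotⱼ = trans (sym slotᵢ) (trans (cong (λ z → direction z y) baseᵢ≡baseⱼ) slotⱼ)

module LowerBound {q : ℕ} (F : FiniteField q) {N : ℕ} (𝒫 : LinePartition F N) where
  open import Data.Nat as ℕ using (suc; _≤_)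
  import Data.Nat.Properties as ℕ
  open import Data.Bool using (Bool; true; _∧_)
  open import Data.Fin using (Fin; _≟_)
  open import Data.Fin.Properties using (any?; *↔×)
  open import Data.Product using (∃₂; _×_; _,_; proj₁; proj₂)
  open import Function using (Inverse; Injection; mk⇔)
  open import Function.Properties.Inverse using (↔⇒↣)
  open import Relation.Binary.PropositionalEquality
  open import Relation.Nullary using (Dec; yes; does; ¬?)
  open import Relation.Nullary.Decidable using (_×-dec_; does-⇔; dec-true)
  open FiniteField F
  open Geometry F
  open LinePartition 𝒫
  open Counting
  open Parity using (module RectangleCover)

  part : Point F → Point F → Fin N
  part x y = proj₁ (covers x y)

  in-part : ∀ {x y i} → part x y ≡ i → A₁ i x × A₂ i y
  in-part {x} {y} refl = proj₂ (covers x y)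

  part-unique : ∀ {i x y} → A₁ i x → A₂ i y → part x y ≡ i
  part-unique {i} {x} {y} x∈ y∈ = disjoint x y (part x y) i (proj₂ (covers x y)) (x∈ , y∈)

  -- With (xᵢ , yᵢ) a pair in part i, the part is the product of the x with part x yᵢ ≡ i and
  -- the y with part xᵢ y ≡ i.
  rows cols : Fin N → Point F → Bool
  rows i x = does (part x (proj₁ (proj₂ (nonempty i))) ≟ i)
  cols i y = does (part (proj₁ (nonempty i)) y ≟ i)

  rectangular : ∀ i x y → rows i x ∧ cols i y ≡ does (part x y ≟ i)
  rectangular i x y = does-⇔ (mk⇔ pair⇒cell cell⇒pair) (part x yᵢ ≟ i ×-dec part xᵢ y ≟ i) (part x y ≟ i)
    where
    xᵢ = proj₁ (nonempty i)
    yᵢ = proj₁ (proj₂ (nonempty i))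
    pair⇒cell : part x yᵢ ≡ i × part xᵢ y ≡ i → part x y ≡ i
    pair⇒cell (xyᵢ≡i , xᵢy≡i) = part-unique (proj₁ (in-part xyᵢ≡i)) (proj₂ (in-part xᵢy≡i))
    cell⇒pair : part x y ≡ i → part x yᵢ ≡ i × part xᵢ y ≡ i
    cell⇒pair xy≡i = part-unique (proj₁ (in-part xy≡i)) (proj₂ (proj₂ (proj₂ (nonempty i)))) ,
                     part-unique (proj₁ (proj₂ (proj₂ (nonempty i)))) (proj₂ (in-part xy≡i))

  -- The affine line ℓ is the graph of t ↦ m t + b, where (m , b) = to ℓ.
  AffineLine : Set
  AffineLine = Fin (q ℕ.* q)

  open Inverse (*↔× {q} {q}) using (to)

  graph : AffineLine → Fin q → Point F
  graph ℓ = graphPoint (proj₁ (to ℓ)) (proj₂ (to ℓ))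

  cell : AffineLine → Fin q → Fin q → Fin N
  cell ℓ t u = part (graph ℓ t) (graph ℓ u)

  Crosses : AffineLine → Fin N → Set
  Crosses ℓ i = ∃₂ λ t u → t ≢ u × cell ℓ t u ≡ i

  crosses? : ∀ ℓ i → Dec (Crosses ℓ i)
  crosses? ℓ i = any? λ t → any? λ u → ¬? (t ≟ u) ×-dec cell ℓ t u ≟ i

  crosses : AffineLine → Fin N → Bool
  crosses ℓ i = does (crosses? ℓ i)

  crosses⇒Crosses : ∀ {ℓ i} → crosses ℓ i ≡ true → Crosses ℓ i
  crosses⇒Crosses {ℓ} {i} _ with crosses? ℓ i
  ... | yes crossing = crossing

  -- Part i lies in L × L, and a line L through two points of the graph of ℓ determines ℓ.
  crosses-unique : ∀ {ℓ ℓ′ i} → crosses ℓ i ≡ true → crosses ℓ′ i ≡ true → ℓ ≡ ℓ′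
  crosses-unique {ℓ} {ℓ′} {i} crosses-ℓ crosses-ℓ′
    with crosses⇒Crosses crosses-ℓ | crosses⇒Crosses crosses-ℓ′
  ... | t , u , t≢u , cellₜᵤ≡i | t′ , u′ , t′≢u′ , cell′≡i =
    Injection.injective (↔⇒↣ *↔×) (sym (cong₂ _,_ (proj₁ same-line) (proj₂ same-line)))
    where
    L = proj₁ (inLine i)
    on-L : ∀ {k x y} → cell k x y ≡ i → OnLine F L (graph k x) × OnLine F L (graph k y)
    on-L cell≡i = proj₂ (inLine i) _ _ (proj₁ (in-part cell≡i)) (proj₂ (in-part cell≡i))
    on-graph-ℓ : ∀ {r s} → OnLine F L (pt₁ r s) → s ≡ proj₁ (to ℓ) * r + proj₂ (to ℓ)
    on-graph-ℓ = onLine-graph L t≢u (proj₁ (on-L cellₜᵤ≡i)) (proj₂ (on-L cellₜᵤ≡i))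
    same-line = affine-unique t′≢u′ (on-graph-ℓ (proj₁ (on-L cell′≡i))) (on-graph-ℓ (proj₂ (on-L cell′≡i)))

  diagonal : AffineLine → Fin q → Bool
  diagonal ℓ t = crosses ℓ (cell ℓ t t)

  graph-bound : ∀ ℓ → q ≤ suc (count (crosses ℓ) ℕ.+ count (diagonal ℓ))
  graph-bound ℓ = RectangleCover.rectangle-bound (cell ℓ) (λ i t → rows i (graph ℓ t)) (λ i u → cols i (graph ℓ u))
                    (λ i t u → rectangular i (graph ℓ t) (graph ℓ u)) (crosses ℓ)
                    (λ {t} {u} t≢u → dec-true (crosses? ℓ (cell ℓ t u)) (t , u , t≢u , refl))

  ∑-crosses : ∑[ ℓ < q ℕ.* q ] count (crosses ℓ) ≤ N
  ∑-crosses = begin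
    ∑[ ℓ < q ℕ.* q ] ∑[ i < N ] indicator (crosses ℓ i)  ≡⟨ ∑-comm (λ ℓ i → indicator (crosses ℓ i)) ⟩
    ∑[ i < N ] count (λ ℓ → crosses ℓ i)
      ≤⟨ ∑-mono-≤ (λ i → count≤1 (λ ℓ → crosses ℓ i) (λ _ _ → crosses-unique)) ⟩
    ∑[ i < N ] 1                                          ≡⟨ ∑-const N 1 ⟩
    N ℕ.* 1                                               ≡⟨ ℕ.*-identityʳ N ⟩
    N                                                     ∎
    where open ℕ.≤-Reasoning

  -- The diagonal cell (P , P) of P = (t , s) is counted for at most one line through P.
  ∑-diagonal : ∑[ ℓ < q ℕ.* q ] count (diagonal ℓ) ≤ q ℕ.* q
  ∑-diagonal = begin
    ∑[ ℓ < q ℕ.* q ] ∑[ t < q ] indicator (diagonal ℓ t)  ≡⟨ ∑-comm (λ ℓ t → indicator (diagonal ℓ t)) ⟩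
    ∑[ t < q ] count (λ ℓ → diagonal ℓ t)
      ≤⟨ ∑-mono-≤ (λ t → count≤-injective (value t) (λ ℓ → diagonal ℓ t) (same-point t)) ⟩
    ∑[ t < q ] q                                          ≡⟨ ∑-const q q ⟩
    q ℕ.* q                                               ∎
    where
    open ℕ.≤-Reasoning
    value : Fin q → AffineLine → Fin q
    value t ℓ = proj₁ (to ℓ) * t + proj₂ (to ℓ)
    same-point : ∀ t {ℓ ℓ′} → diagonal ℓ t ≡ true → diagonal ℓ′ t ≡ true → value t ℓ ≡ value t ℓ′ →
                 ℓ ≡ ℓ′
    same-point t {ℓ} {ℓ′} diagonal-ℓ diagonal-ℓ′ same-value =
      crosses-unique diagonal-ℓ (subst (λ i → crosses ℓ′ i ≡ true) same-cell diagonal-ℓ′)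
      where
      same-cell = cong (λ s → part (pt₁ t s) (pt₁ t s)) (sym same-value)

  cubic-bound : q ℕ.* (q ℕ.* q) ≤ q ℕ.* q ℕ.+ (N ℕ.+ q ℕ.* q)
  cubic-bound = begin
    q ℕ.* (q ℕ.* q)                                                  ≡⟨ ℕ.*-comm q (q ℕ.* q) ⟩
    q ℕ.* q ℕ.* q                                                    ≡⟨ ∑-const (q ℕ.* q) q ⟨
    ∑[ ℓ < q ℕ.* q ] q                                               ≤⟨ ∑-mono-≤ graph-bound ⟩
    ∑[ ℓ < q ℕ.* q ] (1 ℕ.+ (count (crosses ℓ) ℕ.+ count (diagonal ℓ)))
      ≡⟨ ∑-distrib-+ (λ _ → 1) (λ ℓ → count (crosses ℓ) ℕ.+ count (diagonal ℓ)) ⟩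
    ∑[ ℓ < q ℕ.* q ] 1 ℕ.+ ∑[ ℓ < q ℕ.* q ] (count (crosses ℓ) ℕ.+ count (diagonal ℓ))
      ≡⟨ cong₂ ℕ._+_ (trans (∑-const (q ℕ.* q) 1) (ℕ.*-identityʳ (q ℕ.* q)))
                   (∑-distrib-+ (λ ℓ → count (crosses ℓ)) (λ ℓ → count (diagonal ℓ))) ⟩
    q ℕ.* q ℕ.+ (∑[ ℓ < q ℕ.* q ] count (crosses ℓ) ℕ.+ ∑[ ℓ < q ℕ.* q ] count (diagonal ℓ))
      ≤⟨ ℕ.+-monoʳ-≤ (q ℕ.* q) (ℕ.+-mono-≤ ∑-crosses ∑-diagonal) ⟩
    q ℕ.* q ℕ.+ (N ℕ.+ q ℕ.* q)                                          ∎
    where open ℕ.≤-Reasoning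

open import Data.Nat using (zero; suc; _≤_; _+_; _*_; _^_; z≤n; s≤s; >-nonZero⁻¹)
open import Data.Nat.Properties
  using (*-identityʳ; *-monoʳ-≤; *-monoˡ-≤; +-monoˡ-≤; +-cancelˡ-≤; m≤m+n; module ≤-Reasoning)
open import Data.Nat.Tactic.RingSolver using (solve-∀)
open import Data.Fin using (Fin; zero)
open import Data.Fin.Properties using (nonZeroIndex)
open import Data.Product using (∃; _×_; _,_)
open import Relation.Binary.PropositionalEquality using (_≡_; _≢_; refl; sym; trans; cong; subst)
open import Relation.Nullary using (contradiction)

two-elements⇒2≤ : ∀ {n} {x y : Fin n} → x ≢ y → 2 ≤ n
two-elements⇒2≤ {suc zero}    {zero} {zero} x≢y = contradiction refl x≢y
two-elements⇒2≤ {suc (suc n)}               _   = s≤s (s≤s z≤n)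

q^3≡q*[q*q] : ∀ q → q ^ 3 ≡ q * (q * q)
q^3≡q*[q*q] q = cong (λ x → q * (q * x)) (*-identityʳ q)

cancel-quadratic : ∀ T Q N → 3 * Q ≤ T → T ≤ Q + (N + Q) → T ≤ 3 * N
cancel-quadratic T Q N 3Q≤T T≤Q+N+Q = +-cancelˡ-≤ (2 * T) T (3 * N) (begin
  2 * T + T            ≡⟨ 2T+T≡3T T ⟩
  3 * T                ≤⟨ *-monoʳ-≤ 3 T≤Q+N+Q ⟩
  3 * (Q + (N + Q))    ≡⟨ rearrange Q N ⟩
  2 * (3 * Q) + 3 * N  ≤⟨ +-monoˡ-≤ (3 * N) (*-monoʳ-≤ 2 3Q≤T) ⟩
  2 * T + 3 * N        ∎)
  where
  open ≤-Reasoning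
  2T+T≡3T : ∀ T → 2 * T + T ≡ 3 * T
  2T+T≡3T = solve-∀
  rearrange : ∀ Q N → 3 * (Q + (N + Q)) ≡ 2 * (3 * Q) + 3 * N
  rearrange = solve-∀

cubic-bound⇒q³≤8N : ∀ {q N} → 2 ≤ q → 1 ≤ N → q * (q * q) ≤ q * q + (N + q * q) → q ^ 3 ≤ 8 * N
cubic-bound⇒q³≤8N {1} (s≤s ()) _ _
cubic-bound⇒q³≤8N {2} _ 1≤N _ = *-monoʳ-≤ 8 1≤N
cubic-bound⇒q³≤8N {q@(suc (suc (suc _)))} {N} _ _ cubic = begin
  q ^ 3        ≡⟨ q^3≡q*[q*q] q ⟩
  q * (q * q)  ≤⟨ cancel-quadratic (q * (q * q)) (q * q) N (*-monoˡ-≤ (q * q) {3} {q} (s≤s (s≤s (s≤s z≤n)))) cubic ⟩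
  3 * N        ≤⟨ *-monoˡ-≤ N {3} {8} (s≤s (s≤s (s≤s z≤n))) ⟩
  8 * N        ∎
  where open ≤-Reasoning

-- With q = 1 + r, 6 q³ − (q² + q + 1)(q + 1) = 5 r³ + 13 r² + 9 r.
#parts≤6q³ : ∀ {q} → 1 ≤ q → (q * q + suc q) * suc q ≤ 6 * q ^ 3
#parts≤6q³ {q@(suc r)} _ =
  subst ((q * q + suc q) * suc q ≤_) (trans (slack r) (cong (6 *_) (sym (q^3≡q*[q*q] q)))) (m≤m+n _ _)
  where
  slack : ∀ r → (suc r * suc r + suc (suc r)) * suc (suc r) + (5 * (r * (r * r)) + 13 * (r * r) + 9 * r)
                ≡ 6 * (suc r * (suc r * suc r))
  slack = solve-∀

theorem1p1 : ∃ λ (c : ℕ) → ∃ λ (C : ℕ) →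
               ∀ (q : ℕ) (F : FiniteField q) →
                 (∀ (N : ℕ) → LinePartition F N → q ^ 3 ≤ c * N)
                 × (∃ λ (N : ℕ) → LinePartition F N × N ≤ C * q ^ 3)
theorem1p1 = 8 , 6 , λ q F →
  (λ N 𝒫 → cubic-bound⇒q³≤8N (two-elements⇒2≤ (FiniteField.0≢1 F))
                               (>-nonZero⁻¹ N ⦃ nonZeroIndex (LowerBound.part F 𝒫 pt₃ pt₃) ⦄)
                               (LowerBound.cubic-bound F 𝒫)) ,
  (UpperBound.#parts F , UpperBound.linePartition F ,
   #parts≤6q³ (>-nonZero⁻¹ q ⦃ nonZeroIndex (FiniteField.0# F) ⦄))
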